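{- Let $X$ be a finite set, let $t>0$, and let $D=(J_1,J_2,\dots,J_m)$ be a partition of $X$ with $t\ge|J_1|\ge|J_2|\ge\dots\ge|J_m|$. Define $p=\lceil |X|/t\rceil$ and $r=|X|/p$. Then for every integer $a$ with $1\le a\le p-2$ there exists an integer $k$ such that $a\cdot r\le \left|\bigcup_{i=1}^{k}J_i\right|\le (a+1)\cdot r$. -}

module Defs where

open import Data.Nat using (ℕ; _+_; _∸_; _≤_; NonZero)
open import Data.Nat.DivMod using (_/_)
open import Data.Fin using (Fin; _≤_)
open import Data.Fin.Subset using (Subset; ⋃; ∣_∣; _∩_; ⊥; ⊤; Nonempty)
open import Data.List using (List; take; tabulate)
open import Data.Product using (_×_)
open import Relation.Binary.PropositionalEquality using (_≡_; _≢_)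

⌈_/_⌉ : ℕ → (t : ℕ) → .{{NonZero t}} → ℕ
⌈ n / t ⌉ = (n + t ∸ 1) / t

IsPartition : {n m : ℕ} → (Fin m → Subset n) → Set
IsPartition {n} {m} J =
  (∀ i → Nonempty (J i)) ×
  (∀ i j → i ≢ j → J i ∩ J j ≡ ⊥) ×
  (⋃ (tabulate J) ≡ ⊤)

SizesNonIncreasing : {n m : ℕ} → (Fin m → Subset n) → Set
SizesNonIncreasing J = ∀ i j → i Data.Fin.≤ j → ∣ J j ∣ Data.Nat.≤ ∣ J i ∣

-- J₁ ∪ … ∪ Jₖ  (the empty set for k = 0, all blocks for k ≥ m)
firstUnion : {n m : ℕ} → (Fin m → Subset n) → ℕ → Subset n
firstUnion J k = ⋃ (take k (tabulate J))

-- Write sₖ = ∣ J₁ ∪ … ∪ Jₖ ∣ and p = ⌈ n / t ⌉. Since (p - 1) t < n and a < p - 1,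
-- a t p ≤ (a + 1) n. Let k be least with a n ≤ sₖ₊₁ p. If k < a, then
-- sₖ₊₁ p ≤ (k + 1) t p ≤ a t p ≤ (a + 1) n. Otherwise each of the k ≥ a blocks
-- before Jₖ₊₁ is at least as large as Jₖ₊₁, so a ∣ Jₖ₊₁ ∣ p ≤ sₖ p < a n, i.e.
-- ∣ Jₖ₊₁ ∣ p < n, and sₖ₊₁ p = sₖ p + ∣ Jₖ₊₁ ∣ p < (a + 1) n.

module Submission where

open import Defs
open import Data.Nat using (ℕ; zero; suc; _+_; _*_; _∸_; _≤_; _<_; z≤n; s≤s; NonZero; _≤?_)
open import Data.Nat.Properties
open import Data.Nat.DivMod using (_/_; m/n*n≤m)
open import Data.Nat.ListAction using (sum)
open import Data.Nat.ListAction.Properties using (sum-++)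
open import Data.Fin using (Fin) renaming (zero to fzero; suc to fsuc)
open import Data.Fin.Subset using (Subset; ∣_∣; _∩_; _∪_; ⋃; ⊥; ⊤; inside; outside)
open import Data.Fin.Subset.Properties using (∣⊥∣≡0; ∣⊤∣≡n; ∩-zeroʳ; ∩-distribˡ-∪; ∪-identityˡ)
open import Data.Vec using ([]; _∷_)
open import Data.Vec.Properties using (∷-injectiveʳ)
open import Data.List using (List; []; _∷_; [_]; _++_; map; take; tabulate; applyUpTo)
open import Data.List.Properties using (applyUpTo-∷ʳ; take-all; length-tabulate)
open import Data.List.Relation.Unary.All using (All; []; _∷_)
open import Data.List.Relation.Unary.AllPairs using (AllPairs; []; _∷_)
import Data.List.Relation.Unary.AllPairs.Properties as AllPairs
open import Data.Product using (_×_; _,_; ∃-syntax)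
open import Function using (_∘_)
open import Relation.Nullary using (¬_; yes; no)
open import Relation.Nullary.Negation using (contradiction)
open import Relation.Unary using (Pred; Decidable)
open import Relation.Binary.PropositionalEquality using (_≡_; _≢_; refl; sym; trans; subst; cong; cong₂; module ≡-Reasoning)

first-crossing : ∀ {ℓ} {P : Pred ℕ ℓ} → Decidable P → ¬ P 0 →
                 ∀ {m} → P m → ∃[ k ] (¬ P k × P (suc k))
first-crossing P? ¬P0 {zero}  Pm = contradiction Pm ¬P0
first-crossing P? ¬P0 {suc m} Pm with P? m
... | yes Pm′ = first-crossing P? ¬P0 Pm′
... | no ¬Pm′ = m , ¬Pm′ , Pm

Disjoint : ∀ {n} → Subset n → Subset n → Set
Disjoint p q = p ∩ q ≡ ⊥

∣p∪q∣≡∣p∣+∣q∣ : ∀ {n} (p q : Subset n) → Disjoint p q → ∣ p ∪ q ∣ ≡ ∣ p ∣ + ∣ q ∣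
∣p∪q∣≡∣p∣+∣q∣ []             []             _  = refl
∣p∪q∣≡∣p∣+∣q∣ (inside  ∷ p) (outside ∷ q) pq = cong suc (∣p∪q∣≡∣p∣+∣q∣ p q (∷-injectiveʳ pq))
∣p∪q∣≡∣p∣+∣q∣ (outside ∷ p) (inside  ∷ q) pq =
  trans (cong suc (∣p∪q∣≡∣p∣+∣q∣ p q (∷-injectiveʳ pq))) (sym (+-suc ∣ p ∣ ∣ q ∣))
∣p∪q∣≡∣p∣+∣q∣ (outside ∷ p) (outside ∷ q) pq = ∣p∪q∣≡∣p∣+∣q∣ p q (∷-injectiveʳ pq)
∣p∪q∣≡∣p∣+∣q∣ (inside  ∷ p) (inside  ∷ q) ()

Disjoint-⋃ : ∀ {n} {p : Subset n} {qs} → All (Disjoint p) qs → Disjoint p (⋃ qs)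
Disjoint-⋃ {p = p} []                = ∩-zeroʳ p
Disjoint-⋃ {p = p} {q ∷ qs} (pq ∷ pqs) = begin
  p ∩ (q ∪ ⋃ qs)        ≡⟨ ∩-distribˡ-∪ p q (⋃ qs) ⟩
  p ∩ q ∪ p ∩ ⋃ qs      ≡⟨ cong₂ _∪_ pq (Disjoint-⋃ pqs) ⟩
  ⊥ ∪ ⊥                 ≡⟨ ∪-identityˡ ⊥ ⟩
  ⊥                     ∎
  where open ≡-Reasoning

∣⋃∣≡sum : ∀ {n} {ps : List (Subset n)} → AllPairs Disjoint ps → ∣ ⋃ ps ∣ ≡ sum (map ∣_∣ ps)
∣⋃∣≡sum {n} {[]}     []           = ∣⊥∣≡0 n
∣⋃∣≡sum {n} {p ∷ ps} (pps ∷ disj) =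
  trans (∣p∪q∣≡∣p∣+∣q∣ p (⋃ ps) (Disjoint-⋃ pps)) (cong (∣ p ∣ +_) (∣⋃∣≡sum disj))

prefixSum : (ℕ → ℕ) → ℕ → ℕ
prefixSum e k = sum (applyUpTo e k)

prefixSum-suc : ∀ e k → prefixSum e (suc k) ≡ prefixSum e k + e k
prefixSum-suc e k = begin
  sum (applyUpTo e (suc k))          ≡⟨ cong sum (applyUpTo-∷ʳ e k) ⟨
  sum (applyUpTo e k ++ [ e k ])     ≡⟨ sum-++ (applyUpTo e k) [ e k ] ⟩
  prefixSum e k + (e k + 0)          ≡⟨ cong (prefixSum e k +_) (+-identityʳ (e k)) ⟩
  prefixSum e k + e k                ∎
  where open ≡-Reasoning

prefixSum-≤ : ∀ {e t} → (∀ i → e i ≤ t) → ∀ k → prefixSum e k ≤ k * t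
prefixSum-≤ e≤t zero    = z≤n
prefixSum-≤ {e} {t} e≤t (suc k) = begin
  prefixSum e (suc k)   ≡⟨ prefixSum-suc e k ⟩
  prefixSum e k + e k   ≤⟨ +-mono-≤ (prefixSum-≤ e≤t k) (e≤t k) ⟩
  k * t + t             ≡⟨ +-comm (k * t) t ⟩
  suc k * t             ∎
  where open ≤-Reasoning

*-≤-prefixSum : ∀ {e} → (∀ {i j} → i ≤ j → e j ≤ e i) →
                ∀ {k j} → k ≤ j → k * e j ≤ prefixSum e k
*-≤-prefixSum antitone {zero}          _   = z≤n
*-≤-prefixSum {e} antitone {suc k} {j} k<j = begin
  suc k * e j           ≡⟨ +-comm (e j) (k * e j) ⟩
  k * e j + e j         ≤⟨ +-mono-≤ (*-≤-prefixSum antitone (<⇒≤ k<j)) (antitone (<⇒≤ k<j)) ⟩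
  prefixSum e k + e k   ≡⟨ prefixSum-suc e k ⟨
  prefixSum e (suc k)   ∎
  where open ≤-Reasoning

prefixSum-crossing : ∀ {e t p a n} → (∀ i → e i ≤ t) → (∀ {i j} → i ≤ j → e j ≤ e i) →
                     a * t * p ≤ (a + 1) * n →
                     ∀ k → prefixSum e k * p < a * n → prefixSum e (suc k) * p ≤ (a + 1) * n
prefixSum-crossing {e} {t} {p} {a} {n} e≤t antitone atp≤[a+1]n k below with suc k ≤? a
... | yes k<a = begin
  prefixSum e (suc k) * p  ≤⟨ *-monoˡ-≤ p (prefixSum-≤ e≤t (suc k)) ⟩
  suc k * t * p            ≤⟨ *-monoˡ-≤ p (*-monoˡ-≤ t k<a) ⟩
  a * t * p                ≤⟨ atp≤[a+1]n ⟩
  (a + 1) * n              ∎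
  where open ≤-Reasoning
... | no k≮a = <⇒≤ (begin-strict
  prefixSum e (suc k) * p       ≡⟨ cong (_* p) (prefixSum-suc e k) ⟩
  (prefixSum e k + e k) * p     ≡⟨ *-distribʳ-+ p (prefixSum e k) (e k) ⟩
  prefixSum e k * p + e k * p   <⟨ +-mono-< below ek*p<n ⟩
  a * n + n                     ≡⟨ cong (a * n +_) (*-identityˡ n) ⟨
  a * n + 1 * n                 ≡⟨ *-distribʳ-+ n a 1 ⟨
  (a + 1) * n                   ∎)
  where
  open ≤-Reasoning
  ek*p<n : e k * p < n
  ek*p<n = *-cancelˡ-< a (e k * p) n (begin-strict
    a * (e k * p)       ≡⟨ *-assoc a (e k) p ⟨
    a * e k * p         ≤⟨ *-monoˡ-≤ p (*-monoˡ-≤ (e k) (≮⇒≥ k≮a)) ⟩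
    k * e k * p         ≤⟨ *-monoˡ-≤ p (*-≤-prefixSum antitone {k} ≤-refl) ⟩
    prefixSum e k * p   <⟨ below ⟩
    a * n               ∎)

prefixSum-hits : ∀ {e t p a n m} → (∀ i → e i ≤ t) → (∀ {i j} → i ≤ j → e j ≤ e i) →
                 prefixSum e m ≡ n → 0 < a * n → a ≤ p → a * t * p ≤ (a + 1) * n →
                 ∃[ k ] (a * n ≤ prefixSum e k * p × prefixSum e k * p ≤ (a + 1) * n)
prefixSum-hits {e} {t} {p} {a} {n} {m} e≤t antitone total≡n 0<an a≤p atp≤[a+1]n
  = crossing⇒hit (first-crossing (λ k → a * n ≤? prefixSum e k * p) (<⇒≱ 0<an) {m} reachesEnd)
  where
  open ≤-Reasoning
  crossing⇒hit : ∃[ k ] (¬ a * n ≤ prefixSum e k * p × a * n ≤ prefixSum e (suc k) * p) →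
                 ∃[ k ] (a * n ≤ prefixSum e k * p × prefixSum e k * p ≤ (a + 1) * n)
  crossing⇒hit (k , notYet , reached) =
    suc k , reached , prefixSum-crossing {e} {t} {p} {a} {n} e≤t antitone atp≤[a+1]n k (≰⇒> notYet)
  reachesEnd : a * n ≤ prefixSum e m * p
  reachesEnd = begin
    a * n               ≤⟨ *-monoˡ-≤ n a≤p ⟩
    p * n               ≡⟨ *-comm p n ⟩
    n * p               ≡⟨ cong (_* p) total≡n ⟨
    prefixSum e m * p   ∎

-- ∣ J (k+1) ∣ in the paper's 1-based numbering, padded with 0 past the last block.
blockSize : ∀ {n m} → (Fin m → Subset n) → ℕ → ℕ
blockSize {m = zero}  J _       = 0
blockSize {m = suc m} J zero    = ∣ J fzero ∣
blockSize {m = suc m} J (suc k) = blockSize (J ∘ fsuc) k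

blockSize-≤ : ∀ {n m t} {J : Fin m → Subset n} → (∀ i → ∣ J i ∣ ≤ t) → ∀ k → blockSize J k ≤ t
blockSize-≤ {m = zero}  _   _       = z≤n
blockSize-≤ {m = suc m} J≤t zero    = J≤t fzero
blockSize-≤ {m = suc m} J≤t (suc k) = blockSize-≤ (J≤t ∘ fsuc) k

blockSize-antitone : ∀ {n m} {J : Fin m → Subset n} → SizesNonIncreasing J →
                     ∀ {i j} → i ≤ j → blockSize J j ≤ blockSize J i
blockSize-antitone {m = zero}  _ _ = z≤n
blockSize-antitone {m = suc m} J↓ {zero}  {zero}  _ = ≤-refl
blockSize-antitone {m = suc m} J↓ {zero}  {suc j} _ = blockSize-≤ (λ i → J↓ fzero (fsuc i) z≤n) j
blockSize-antitone {m = suc m} J↓ {suc i} {suc j} (s≤s i≤j) =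
  blockSize-antitone (λ i j i≤j → J↓ (fsuc i) (fsuc j) (s≤s i≤j)) i≤j

prefixSum-0 : ∀ k → prefixSum (λ _ → 0) k ≡ 0
prefixSum-0 zero    = refl
prefixSum-0 (suc k) = prefixSum-0 k

sum-take-tabulate : ∀ {n m} (J : Fin m → Subset n) k →
                    sum (map ∣_∣ (take k (tabulate J))) ≡ prefixSum (blockSize J) k
sum-take-tabulate {m = zero}  J zero    = refl
sum-take-tabulate {m = zero}  J (suc k) = sym (prefixSum-0 k)
sum-take-tabulate {m = suc m} J zero    = refl
sum-take-tabulate {m = suc m} J (suc k) = cong (∣ J fzero ∣ +_) (sum-take-tabulate (J ∘ fsuc) k)

∣firstUnion∣≡prefixSum : ∀ {n m} {J : Fin m → Subset n} → (∀ i j → i ≢ j → Disjoint (J i) (J j)) →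
                         ∀ k → ∣ firstUnion J k ∣ ≡ prefixSum (blockSize J) k
∣firstUnion∣≡prefixSum {J = J} disjoint k =
  trans (∣⋃∣≡sum (AllPairs.take⁺ k (AllPairs.tabulate⁺ (disjoint _ _)))) (sum-take-tabulate J k)

∣firstUnion-all∣ : ∀ {n m} (J : Fin m → Subset n) → ⋃ (tabulate J) ≡ ⊤ → ∣ firstUnion J m ∣ ≡ n
∣firstUnion-all∣ {n} {m} J covers = begin
  ∣ ⋃ (take m (tabulate J)) ∣   ≡⟨ cong (∣_∣ ∘ ⋃) (take-all m (tabulate J) (≤-reflexive (length-tabulate J))) ⟩
  ∣ ⋃ (tabulate J) ∣            ≡⟨ cong ∣_∣ covers ⟩
  ∣ ⊤ {n} ∣                     ≡⟨ ∣⊤∣≡n n ⟩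
  n                             ∎
  where open ≡-Reasoning

⌈/⌉*<+ : ∀ n t .{{_ : NonZero t}} → ⌈ n / t ⌉ * t < n + t
⌈/⌉*<+ n t@(suc t′) = begin-strict
  ⌈ n / t ⌉ * t   ≤⟨ m/n*n≤m (n + t ∸ 1) t ⟩
  n + t ∸ 1       ≡⟨ cong (_∸ 1) (+-suc n t′) ⟩
  n + t′          <⟨ +-monoʳ-< n (n<1+n t′) ⟩
  n + t           ∎
  where open ≤-Reasoning

<⌈/⌉⇒*<  : ∀ {n t} .{{_ : NonZero t}} {q} → q < ⌈ n / t ⌉ → q * t < n
<⌈/⌉⇒*< {n} {t} {q} q<p = +-cancelʳ-< t (q * t) n (begin-strict
  q * t + t       ≡⟨ +-comm (q * t) t ⟩
  suc q * t       ≤⟨ *-monoˡ-≤ t q<p ⟩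
  ⌈ n / t ⌉ * t   <⟨ ⌈/⌉*<+ n t ⟩
  n + t           ∎)
  where open ≤-Reasoning

a*t*p≤[a+1]*n : ∀ {a t n} p → a < p → (∀ {q} → q < p → q * t < n) → a * t * p ≤ (a + 1) * n
a*t*p≤[a+1]*n {a} {t} {n} (suc q) (s≤s a≤q) <p⇒*<n = begin
  a * t * suc q       ≡⟨ *-assoc a t (suc q) ⟩
  a * (t * suc q)     ≡⟨ cong (a *_) (*-comm t (suc q)) ⟩
  a * (suc q * t)     ≡⟨ *-assoc a (suc q) t ⟨
  a * suc q * t       ≤⟨ *-monoˡ-≤ t a*[1+q]≤[1+a]*q ⟩
  (a + 1) * q * t     ≡⟨ *-assoc (a + 1) q t ⟩
  (a + 1) * (q * t)   ≤⟨ *-monoʳ-≤ (a + 1) (<⇒≤ (<p⇒*<n ≤-refl)) ⟩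
  (a + 1) * n         ∎
  where
  open ≤-Reasoning
  a*[1+q]≤[1+a]*q : a * suc q ≤ (a + 1) * q
  a*[1+q]≤[1+a]*q = begin
    a * suc q         ≡⟨ *-suc a q ⟩
    a + a * q         ≤⟨ +-monoˡ-≤ (a * q) a≤q ⟩
    suc a * q         ≡⟨ cong (_* q) (+-comm 1 a) ⟩
    (a + 1) * q       ∎

≤∸2⇒< : ∀ {a} p → 0 < a → a ≤ p ∸ 2 → a < p
≤∸2⇒< zero          (s≤s _) ()
≤∸2⇒< (suc zero)    (s≤s _) ()
≤∸2⇒< (suc (suc p)) _       a≤p = m≤n⇒m≤1+n (s≤s a≤p)

lemma5 : (n t m : ℕ) → .{{_ : NonZero t}} → (J : Fin m → Subset n) →
         IsPartition J → SizesNonIncreasing J → (∀ i → ∣ J i ∣ ≤ t) →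
         (a : ℕ) → 1 ≤ a → a ≤ ⌈ n / t ⌉ ∸ 2 →
         ∃[ k ] ((a * n ≤ ∣ firstUnion J k ∣ * ⌈ n / t ⌉) ×
                 (∣ firstUnion J k ∣ * ⌈ n / t ⌉ ≤ (a + 1) * n))
lemma5 n t m J (_ , disjoint , covers) J↓ J≤t a 0<a a≤p∸2 =
  fromPrefixSums (prefixSum-hits {m = m} (blockSize-≤ J≤t) (blockSize-antitone J↓) total≡n
                                 (*-mono-≤ 0<a 0<n) (<⇒≤ a<p) (a*t*p≤[a+1]*n p a<p <⌈/⌉⇒*<))
  where
  p = ⌈ n / t ⌉
  a<p : a < p
  a<p = ≤∸2⇒< p 0<a a≤p∸2
  0<n : 0 < n
  0<n = <⌈/⌉⇒*< {n} {t} (≤-<-trans z≤n a<p)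
  total≡n : prefixSum (blockSize J) m ≡ n
  total≡n = trans (sym (∣firstUnion∣≡prefixSum disjoint m)) (∣firstUnion-all∣ J covers)
  fromPrefixSums : ∃[ k ] (a * n ≤ prefixSum (blockSize J) k * p × prefixSum (blockSize J) k * p ≤ (a + 1) * n) →
                   ∃[ k ] (a * n ≤ ∣ firstUnion J k ∣ * p × ∣ firstUnion J k ∣ * p ≤ (a + 1) * n)
  fromPrefixSums (k , lower , upper) =
    k , subst (λ s → a * n ≤ s * p) size≡ lower , subst (λ s → s * p ≤ (a + 1) * n) size≡ upper
    where size≡ = sym (∣firstUnion∣≡prefixSum disjoint k)
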